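{- Let $\pi_0,\pi_1\in\mathrm{FFT}$ be such that $\mathrm{roots}(\pi_0)=\mathrm{roots}(\pi_1)$ and $\mathrm{tf}(\pi_0,w)=\mathrm{tf}(\pi_1,w)$ for every $w\in\mathrm{roots}(\pi_0)$. Then $\pi_0=\pi_1$ (same nodes, same labels, same partition).
   Context: Words are finite sequences of natural numbers; $\mathbb{N}^*$ the set of words, $\epsilon$ the empty word, $\mathbb{N}^+$ the nonempty words; concatenation is juxtaposition; $\sqsubseteq$ is the prefix order ($\sqsubset$ strict). A tree is a prefix-closed set of words (nodes) with a labelling $\ell$; trees are finitely branching. Fix a set $A$ of labels and $*\notin A$. A set $F\subseteq\mathbb{N}^*$ has the fragmentation properties if it is finite, has a $\sqsubseteq$-minimum, and is convex (if $w,v\in F$ and $w\sqsubseteq u\sqsubseteq v$ then $u\in F$). A finite-fragmented tree is a pair $\pi=(\tau,\mathcal{F})$ with $\tau$ a (possibly infinite) tree labelled in $A$ and $\mathcal{F}$ a partition of its nodes into sets with the fragmentation properties; $\sim^\pi$ the associated equivalence; $\mathrm{FFT}$ the set of these. $\mathrm{roots}(\pi)$ is the set of minima of the blocks. For roots $w,v$: $w\lhd v$ iff $w\sqsubset v$ and no root $u$ satisfies $w\sqsubset u\sqsubset v$. For $w\in\mathrm{roots}(\pi)$, the tree fragment $\mathrm{tf}(\pi,w)$ is the finite tree (labelled in $A\cup\{*\}$) with nodes $\{v\in\mathbb{N}^*: w\sim^\pi wv\}\cup\{u\in\mathbb{N}^+: w\lhd wu\}$, labelled $\ell^\pi(wv)$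 at $v$ when $w\sim^\pi wv$ and $*$ at $u$ when $w\lhd wu$. -}

module Defs where

open import Data.Nat using (ℕ; _<_)
open import Data.List using (List; []; _∷_; _++_; [_])
open import Data.List.Membership.Propositional using (_∈_)
open import Data.Product using (Σ; ∃; ∃-syntax; _×_; _,_)
open import Data.Sum using (_⊎_)
open import Data.Maybe using (Maybe; just; nothing)
open import Relation.Nullary using (¬_)
open import Relation.Binary.PropositionalEquality using (_≡_; _≢_)
open import Function.Bundles using (_⇔_)

Word : Set
Word = List ℕ

_⊑_ : Word → Word → Set
u ⊑ v = ∃[ t ] (u ++ t ≡ v)

_⊏_ : Word → Word → Set
u ⊏ v = ∃[ t ] (t ≢ [] × u ++ t ≡ v)

Finite : (Word → Set) → Set
Finite F = ∃[ L ] (∀ v → F v → v ∈ L)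

HasMinimum : (Word → Set) → Set
HasMinimum F = ∃[ m ] (F m × (∀ v → F v → m ⊑ v))

Convex : (Word → Set) → Set
Convex F = ∀ w u v → F w → F v → w ⊑ u → u ⊑ v → F u

FragProps : (Word → Set) → Set
FragProps F = Finite F × HasMinimum F × Convex F

-- The partition F of the nodes is
-- given by its associated equivalence relation ∼ on the nodes; the blocks
-- are the equivalence classes, each of which has the fragmentation properties.
record FFT (A : Set) : Set₁ where
  field
    node  : Word → Set
    lab   : Word → A
    _∼_   : Word → Word → Set
    prefix-closed : ∀ u v → node v → u ⊑ v → node u
    fin-branching : ∀ w → node w → ∃[ n ] (∀ i → node (w ++ [ i ]) → i < n)
    ∼-node  : ∀ u v → u ∼ v → node u × node v
    ∼-refl  : ∀ u → node u → u ∼ u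
    ∼-sym   : ∀ u v → u ∼ v → v ∼ u
    ∼-trans : ∀ u v w → u ∼ v → v ∼ w → u ∼ w
    blocks  : ∀ u → node u → FragProps (λ v → u ∼ v)

open FFT public

IsRoot : {A : Set} → FFT A → Word → Set
IsRoot π w = node π w × (∀ v → _∼_ π w v → w ⊑ v)

_◁[_]_ : {A : Set} → Word → FFT A → Word → Set
w ◁[ π ] v = IsRoot π w × IsRoot π v × w ⊏ v
           × ¬ (∃[ u ] (IsRoot π u × w ⊏ u × u ⊏ v))

-- Tree fragment tf(π,w): labels in A ∪ {*}, encoded as Maybe A with
-- nothing = *.  tfNode π w v : v is a node of tf(π,w);
-- tfLab π w v x : v is a node of tf(π,w) with label x.
tfNode : {A : Set} → FFT A → Word → Word → Set
tfNode π w v = _∼_ π w (w ++ v) ⊎ (v ≢ [] × w ◁[ π ] (w ++ v))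

tfLab : {A : Set} → FFT A → Word → Word → Maybe A → Set
tfLab π w v x = (_∼_ π w (w ++ v) × x ≡ just (lab π (w ++ v)))
              ⊎ (v ≢ [] × w ◁[ π ] (w ++ v) × x ≡ nothing)

SameTf : {A : Set} → FFT A → FFT A → Word → Set
SameTf π₀ π₁ w = (∀ v → tfNode π₀ w v ⇔ tfNode π₁ w v)
               × (∀ v x → tfLab π₀ w v x ⇔ tfLab π₁ w v x)

SameFFT : {A : Set} → FFT A → FFT A → Set
SameFFT π₀ π₁ = (∀ v → node π₀ v ⇔ node π₁ v)
              × (∀ v → node π₀ v → lab π₀ v ≡ lab π₁ v)
              × (∀ u v → _∼_ π₀ u v ⇔ _∼_ π₁ u v)

-- Every node v lies in a block whose minimum m is a root, so v = m t and t is a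
-- node of tf(π₀, m) carrying the label ℓ(v), not *.  Since tf(π₁, m) is the same
-- labelled tree, t is also a non-* node there, i.e. m ∼ v in π₁ with the same
-- label.  Blocks are recovered by going through their common root; the converse
-- inclusions hold symmetrically because the roots of π₀ and π₁ coincide.
module Submission where

open import Defs
open import Data.List using (_++_)
open import Data.Maybe using (just)
open import Data.Maybe.Properties using (just-injective)
open import Data.Product using (Σ; _×_; _,_; proj₁; proj₂)
open import Data.Sum using (inj₁; inj₂)
open import Function.Bundles using (_⇔_; mk⇔; Equivalence)
open import Relation.Binary.PropositionalEquality using (_≡_; refl)

module _ {A : Set} (π : FFT A) where

  root-of-block : ∀ v → node π v → Σ Word λ m → IsRoot π m × _∼_ π m v
  root-of-block v nv with blocks π v nv
  ... | _ , (m , v∼m , m-min) , _ =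
      m
    , (proj₂ (∼-node π v m v∼m) , λ u m∼u → m-min u (∼-trans π v m u v∼m m∼u))
    , ∼-sym π v m v∼m

  tfLab-block : ∀ {w v} → _∼_ π w (w ++ v) → tfLab π w v (just (lab π (w ++ v)))
  tfLab-block w∼wv = inj₁ (w∼wv , refl)

  tfLab-just : ∀ {w v a} → tfLab π w v (just a) → _∼_ π w (w ++ v) × a ≡ lab π (w ++ v)
  tfLab-just (inj₁ (w∼wv , eq)) = w∼wv , just-injective eq
  tfLab-just (inj₂ (_ , _ , ()))

module Transfer {A : Set} (π π′ : FFT A)
  (tfLab⇒ : ∀ w → IsRoot π w → ∀ v x → tfLab π w v x → tfLab π′ w v x) where

  block⇒ : ∀ m v → IsRoot π m → _∼_ π m v → _∼_ π′ m v × lab π v ≡ lab π′ v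
  block⇒ m v root m∼v with proj₂ root v m∼v
  ... | t , refl = tfLab-just π′ (tfLab⇒ m root t _ (tfLab-block π m∼v))

  node⇒ : ∀ v → node π v → node π′ v
  node⇒ v nv with root-of-block π v nv
  ... | m , root , m∼v = proj₂ (∼-node π′ m v (proj₁ (block⇒ m v root m∼v)))

  lab≡ : ∀ v → node π v → lab π v ≡ lab π′ v
  lab≡ v nv with root-of-block π v nv
  ... | m , root , m∼v = proj₂ (block⇒ m v root m∼v)

  ∼⇒ : ∀ u v → _∼_ π u v → _∼_ π′ u v
  ∼⇒ u v u∼v with root-of-block π u (proj₁ (∼-node π u v u∼v))
  ... | m , root , m∼u =
    ∼-trans π′ u m v (∼-sym π′ m u (proj₁ (block⇒ m u root m∼u)))
                     (proj₁ (block⇒ m v root (∼-trans π m u v m∼u u∼v)))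

lemma2p12 : {A : Set} (π₀ π₁ : FFT A)
    → (∀ w → IsRoot π₀ w ⇔ IsRoot π₁ w)
    → (∀ w → IsRoot π₀ w → SameTf π₀ π₁ w)
    → SameFFT π₀ π₁
lemma2p12 π₀ π₁ sameRoots sameTf =
    (λ v → mk⇔ (T₀₁.node⇒ v) (T₁₀.node⇒ v))
  , T₀₁.lab≡
  , (λ u v → mk⇔ (T₀₁.∼⇒ u v) (T₁₀.∼⇒ u v))
  where
  open Equivalence
  module T₀₁ = Transfer π₀ π₁ (λ w r v x → to (proj₂ (sameTf w r) v x))
  module T₁₀ = Transfer π₁ π₀ (λ w r v x → from (proj₂ (sameTf w (from (sameRoots w) r)) v x))
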